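{- Let $L=(X,\le)$ be a finite upper locally distributive lattice with set of meet-irreducibles $M$. If $L\in L(CFG)$, then for every $m\in M$ the system $\mathcal{E}(m)$ has a solution in non-negative integers.
   Context: $\mathbf{0}$ is the least element; $x\prec y$ means $y$ covers $x$; $M_x=\{m\in M:x\le m\}$ where $M$ is the set of elements with exactly one upper cover. $L$ is upper locally distributive if $[x,x^{+}]$ is a Boolean lattice for every $x\neq\mathbf{1}$, $x^{+}$ being the join of the upper covers of $x$; then for each cover $x\prec y$, $M_x\setminus M_y$ has exactly one element $\mathfrak{m}(x,y)$. For $m\in M$, $\mathfrak{U}_m$ is the set of minimal elements of $\{x:\exists y,\ x\prec y,\ \mathfrak{m}(x,y)=m\}$ and $\mathfrak{L}_m$ the set of maximal elements of $X\setminus\bigcup_{a\in\mathfrak{U}_m}\{x:a\le x\}$. $\mathcal{E}(m)$: if $\mathfrak{U}_m=\{\mathbf{0}\}$ it is $w\ge1$; otherwise, in variables $w$ and $e_x$ ($x\in\bigcup_{a\in\mathfrak{U}_m\cup\mathfrak{L}_m}(M\setminus M_a)$), it consists of $\sum_{x\in M\setminus M_a}e_x<w$ for $a\in\mathfrak{L}_m$ and $w\le\sum_{x\in M\setminus M_a}e_x$ for $a\in\mathfrak{U}_m$. Chip Firing Games: $G$ a finite directed multigraph; a sink is a vertex all of whose outgoing edges are loops; configurations are maps $V(G)\to\mathbb{N}$; a non-sink $v$ is firable in $c$ if $c(v)\ge deg^{+}(v)$, and firing moves one chip from $v$ along each outgoing edge. $CFG(G,\mathcal{O})$ is the set of configurations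 reachable from $\mathcal{O}$, ordered by reachability; if no infinite firing sequence exists it is a lattice, and lattices isomorphic to it are generated by the game. $L(CFG)$ is the class of lattices generated by such games. -}

module Defs where

open import Level using (0ℓ)
open import Data.Nat using (ℕ; zero; suc; _+_; _∸_; _≤_; _<_)
open import Data.Fin using (Fin; _≟_)
open import Data.List using (List; map; allFin)
open import Data.Nat.ListAction using (sum)
open import Data.List.Membership.Propositional using (_∈_)
open import Data.List.Relation.Unary.Unique.Propositional using (Unique)
open import Data.Vec using (Vec; lookup; tabulate)
open import Data.Bool using (if_then_else_)
open import Data.Product using (Σ; ∃; _×_; _,_)
open import Relation.Nullary using (¬_)
open import Relation.Nullary.Decidable using (⌊_⌋)
open import Relation.Binary using (Rel; Decidable)
open import Relation.Binary.PropositionalEquality using (_≡_; _≢_)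
open import Relation.Binary.Construct.Closure.ReflexiveTransitive using (Star)
open import Relation.Binary.Lattice using (IsLattice)
open import Algebra.Core using (Op₂)

_⇔_ : Set → Set → Set
A ⇔ B = (A → B) × (B → A)

record FinLattice : Set₁ where
  field
    n         : ℕ
    _≤L_      : Rel (Fin n) 0ℓ
    _∨_       : Op₂ (Fin n)
    _∧_       : Op₂ (Fin n)
    isLattice : IsLattice _≡_ _≤L_ _∨_ _∧_
    ≤-dec     : Decidable _≤L_

module LatticeNotions (L : FinLattice) where
  open FinLattice L

  X : Set
  X = Fin n

  _<L_ : X → X → Set
  x <L y = x ≤L y × x ≢ y

  _≺_ : X → X → Set
  x ≺ y = x <L y × ¬ (Σ X λ z → x <L z × z <L y)

  IsBottom : X → Set
  IsBottom x = ∀ y → x ≤L y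

  IsTop : X → Set
  IsTop x = ∀ y → y ≤L x

  IsMeetIrr : X → Set
  IsMeetIrr x = Σ X λ y → x ≺ y × (∀ z → x ≺ z → z ≡ y)

  IsJoinOfCovers : X → X → Set
  IsJoinOfCovers x p = (∀ y → x ≺ y → y ≤L p)
                     × (∀ u → (∀ y → x ≺ y → y ≤L u) → p ≤L u)

  InInterval : X → X → X → Set
  InInterval x p a = x ≤L a × a ≤L p

  IsBooleanInterval : X → X → Set
  IsBooleanInterval x p =
      (∀ a b c → InInterval x p a → InInterval x p b → InInterval x p c →
         a ∧ (b ∨ c) ≡ (a ∧ b) ∨ (a ∧ c))
    × (∀ a → InInterval x p a →
         Σ X λ b → InInterval x p b × (a ∧ b ≡ x) × (a ∨ b ≡ p))

  UpperLocallyDistributive : Set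
  UpperLocallyDistributive =
    ∀ x → ¬ IsTop x → ∀ p → IsJoinOfCovers x p → IsBooleanInterval x p

  InMx : X → X → Set
  InMx x m = IsMeetIrr m × x ≤L m

  -- m = 𝔪(x,y) : x ≺ y and m is the (unique, under ULD) element of M_x ∖ M_y
  IsLabel : X → X → X → Set
  IsLabel x y m = x ≺ y × InMx x m × ¬ InMx y m

  LabelSrc : X → X → Set
  LabelSrc m x = Σ X λ y → IsLabel x y m

  InU : X → X → Set
  InU m a = LabelSrc m a × (∀ b → LabelSrc m b → b ≤L a → b ≡ a)

  AboveU : X → X → Set
  AboveU m x = Σ X λ a → InU m a × a ≤L x

  InLm : X → X → Set
  InLm m a = ¬ AboveU m a × (∀ b → ¬ AboveU m b → a ≤L b → b ≡ a)

  InMminusMa : X → X → Set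
  InMminusMa a x = IsMeetIrr x × ¬ (a ≤L x)

  SumOver : (X → Set) → (X → ℕ) → ℕ → Set
  SumOver S e s = Σ (List X) λ l → Unique l × (∀ x → (x ∈ l) ⇔ S x)
                                 × sum (map e l) ≡ s

  UIsBottomSingleton : X → Set
  UIsBottomSingleton m = ∀ a → InU m a ⇔ IsBottom a

  -- (w , e) is a solution in ℕ of the system 𝓔(m).  The variables e_x are
  -- given for every x ∈ X; values outside the index set of 𝓔(m) are unused.
  SolvesE : X → ℕ → (X → ℕ) → Set
  SolvesE m w e =
      (UIsBottomSingleton m → 1 ≤ w)
    × (¬ UIsBottomSingleton m →
          (∀ a → InLm m a → Σ ℕ λ s → SumOver (InMminusMa a) e s × s < w)
        × (∀ a → InU m a → Σ ℕ λ s → SumOver (InMminusMa a) e s × w ≤ s))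

  HasNatSolution : X → Set
  HasNatSolution m = Σ ℕ λ w → Σ (X → ℕ) λ e → SolvesE m w e

-- Chip firing games.  A finite directed multigraph on vertices Fin k is
-- given by edge multiplicities E u v (number of edges u → v, loops allowed).

module CFGNotions {k : ℕ} (E : Fin k → Fin k → ℕ) where

  Config : Set
  Config = Vec ℕ k

  outdeg : Fin k → ℕ
  outdeg v = sum (map (E v) (allFin k))

  IsSink : Fin k → Set
  IsSink v = ∀ w → w ≢ v → E v w ≡ 0

  -- firing v: one chip leaves v along each outgoing edge
  fire : Fin k → Config → Config
  fire v c = tabulate λ w →
    (lookup c w + E v w) ∸ (if ⌊ w ≟ v ⌋ then outdeg v else 0)

  Step : Config → Config → Set
  Step c c' = Σ (Fin k) λ v → ¬ IsSink v × outdeg v ≤ lookup c v × c' ≡ fire v c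

  Reach : Config → Config → Set
  Reach = Star Step

  NoInfiniteFiring : Config → Set
  NoInfiniteFiring O =
    ¬ (Σ (ℕ → Config) λ s → s 0 ≡ O × (∀ i → Step (s i) (s (suc i))))

-- L is isomorphic (as an ordered set) to CFG(G,O) = ({c : O →* c}, reachability)
GeneratedBy : (L : FinLattice) {k : ℕ} (E : Fin k → Fin k → ℕ) → Vec ℕ k → Set
GeneratedBy L {k} E O =
  Σ (Fin (FinLattice.n L) → Vec ℕ k) λ f →
      (∀ x → Reach O (f x))
    × (∀ c → Reach O c → Σ (Fin (FinLattice.n L)) λ x → f x ≡ c)
    × (∀ x y → FinLattice._≤L_ L x y ⇔ Reach (f x) (f y))
  where open CFGNotions E

InLCFG : FinLattice → Set
InLCFG L = Σ ℕ λ k → Σ (Fin k → Fin k → ℕ) λ E → Σ (Vec ℕ k) λ O →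
  CFGNotions.NoInfiniteFiring E O × GeneratedBy L E O

module Submission where

-- Identify L with the configurations CFG(G,O) via f.  Firings commute
-- (diamond), and pushing a firing along a path with the help of the diamond
-- shows: the covers of L are exactly the single firings; every cover t ≺ t'
-- has exactly one label, the meet-irreducible x with t ≤ x and t' ≰ x; and
-- every cover leaving ↓x fires the same vertex, the vertex of x.  Hence, for
-- a weight φ on vertices, W φ c = ∑_{x ∈ M ∖ M_c} φ(vertex of x) is the total
-- φ-weight of the firings leading from 𝟎 to c.  Let v be the vertex of m.
-- Chip conservation at v reads  c(v) + Out c = O(v) + In c  (chips sent and
-- received by v).  Elements of 𝔘_m have sent K = Out m chips and can fire v;
-- elements of 𝔏_m lie below m and have sent fewer chips or cannot fire v.
-- So e = (In-weight) + D·(Out-weight), for D large, puts the sums over 𝔏_m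
-- below and those over 𝔘_m above the threshold w = (D·K + K + deg v) ∸ O(v).

open import Level using (0ℓ)
open import Data.Bool using (if_then_else_)
open import Data.Nat using (ℕ; zero; suc; _+_; _*_; _∸_; _≤_; _<_; z≤n; s≤s)
open import Data.Nat.Properties hiding (_≟_)
open import Data.Nat.Induction using (<-wellFounded)
open import Data.Nat.ListAction using (sum)
open import Data.Nat.Tactic.RingSolver using (solve-∀)
open import Data.Fin using (Fin; _≟_) renaming (zero to fzero; suc to fsuc)
open import Data.Fin.Properties using (any?; all?)
open import Data.List using (map; filter; tabulate; allFin)
open import Data.List.Relation.Unary.Unique.Propositional.Properties using (filter⁺; allFin⁺)
open import Data.List.Membership.Propositional.Properties using (∈-filter⁺; ∈-filter⁻; ∈-allFin)
open import Data.Vec using (Vec; lookup)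
open import Data.Vec.Properties using (lookup∘tabulate; tabulate∘lookup; tabulate-cong)
open import Data.Product using (Σ; _×_; _,_; proj₁; proj₂)
open import Data.Sum using (_⊎_; inj₁; inj₂; [_,_])
open import Data.Empty using (⊥; ⊥-elim)
open import Function using (_∘_; id; flip)
open import Induction.WellFounded using (Acc; acc)
open import Relation.Nullary using (Dec; does; yes; no; ¬_)
open import Relation.Nullary.Decidable using (_×-dec_; ¬?; _→-dec_; isYes≗does)
open import Relation.Unary using (Pred) renaming (Decidable to DecidablePred)
open import Relation.Binary using (Rel; Decidable; IsPartialOrder)
open import Relation.Binary.Lattice using (IsLattice)
import Relation.Binary.Construct.Flip.EqAndOrd as Flip
open import Relation.Binary.Construct.Closure.ReflexiveTransitive using (Star; ε; _◅_; _◅◅_; gmap)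
open import Relation.Binary.PropositionalEquality
  using (_≡_; _≢_; refl; sym; trans; cong; cong₂; subst; module ≡-Reasoning)
open import Algebra.Properties.Semiring.Sum +-*-semiring
  using (sum-cong-≗; sum-replicate-zero; ∑-distrib-+; *-distribˡ-sum) renaming (sum to ∑)
open import Algebra.Properties.CommutativeSemigroup +-commutativeSemigroup
  using (x∙yz≈xz∙y; xy∙z≈xz∙y; xy∙z≈x∙zy; x∙yz≈y∙zx)
open import Defs

-- select d n : the number n if the decision d is positive, 0 otherwise.
-- (This is the shape of the correction term in the definition of firing.)
select : ∀ {A : Set} → Dec A → ℕ → ℕ
select d n = if does d then n else 0

module _ {A : Set} {n : ℕ} where

  select-yes : (d : Dec A) → A → select d n ≡ n
  select-yes (yes _)  _ = refl
  select-yes (no ¬a)  a = ⊥-elim (¬a a)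

  select-no : (d : Dec A) → ¬ A → select d n ≡ 0
  select-no (yes a) ¬a = ⊥-elim (¬a a)
  select-no (no _)  _  = refl

select-mono : ∀ {A B : Set} {n} (a : Dec A) (b : Dec B) → (A → B) → select a n ≤ select b n
select-mono (no _)  _ _  = z≤n
select-mono (yes p) b A⇒B = ≤-reflexive (sym (select-yes b (A⇒B p)))

select-⊎ : ∀ {A' A B : Set} {n} (a' : Dec A') (a : Dec A) (b : Dec B) →
           (A' → A ⊎ B) → (A ⊎ B → A') → (A → ¬ B) →
           select a' n ≡ select a n + select b n
select-⊎ a' (yes p) (yes q) _  _    disj = ⊥-elim (disj p q)
select-⊎ a' (yes p) (no _)  _  from _    = trans (select-yes a' (from (inj₁ p))) (sym (+-identityʳ _))
select-⊎ a' (no _)  (yes q) _  from _    = select-yes a' (from (inj₂ q))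
select-⊎ a' (no ¬p) (no ¬q) to _    _    = select-no a' ([ ¬p , ¬q ] ∘ to)

select-linear : ∀ {A : Set} (a : Dec A) m D n → select a (m + D * n) ≡ select a m + D * select a n
select-linear (yes _) m D n = refl
select-linear (no _)  m D n = sym (*-zeroʳ D)

∑-mono-≤ : ∀ {n} {g h : Fin n → ℕ} → (∀ i → g i ≤ h i) → ∑ g ≤ ∑ h
∑-mono-≤ {zero}  _   = z≤n
∑-mono-≤ {suc n} g≤h = +-mono-≤ (g≤h fzero) (∑-mono-≤ (g≤h ∘ fsuc))

∑-mono-< : ∀ {n} {g h : Fin n → ℕ} → (∀ i → g i ≤ h i) → (j : Fin n) → g j < h j → ∑ g < ∑ h
∑-mono-< g≤h fzero    gj<hj = +-mono-<-≤ gj<hj (∑-mono-≤ (g≤h ∘ fsuc))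
∑-mono-< g≤h (fsuc j) gj<hj = +-mono-≤-< (g≤h fzero) (∑-mono-< (g≤h ∘ fsuc) j gj<hj)

∑-zero : ∀ {n} {g : Fin n → ℕ} → (∀ i → g i ≡ 0) → ∑ g ≡ 0
∑-zero {n} g≡0 = trans (sum-cong-≗ g≡0) (sum-replicate-zero n)

∑-term : ∀ {n} (g : Fin n → ℕ) j → g j ≤ ∑ g
∑-term g fzero    = m≤m+n _ _
∑-term g (fsuc j) = ≤-trans (∑-term (g ∘ fsuc) j) (m≤n+m _ _)

∑-two-terms : ∀ {n} (g : Fin n → ℕ) {i j} → i ≢ j → g i + g j ≤ ∑ g
∑-two-terms g {fzero}  {fzero}  i≢j = ⊥-elim (i≢j refl)
∑-two-terms g {fzero}  {fsuc j} _   = +-monoʳ-≤ (g fzero) (∑-term (g ∘ fsuc) j)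
∑-two-terms g {fsuc i} {fzero}  _   =
  ≤-trans (≤-reflexive (+-comm (g (fsuc i)) (g fzero))) (+-monoʳ-≤ (g fzero) (∑-term (g ∘ fsuc) i))
∑-two-terms g {fsuc i} {fsuc j} i≢j =
  ≤-trans (∑-two-terms (g ∘ fsuc) (i≢j ∘ cong fsuc)) (m≤n+m _ _)

∑-select-≡ : ∀ {n} (g : Fin n → ℕ) j → ∑ (λ i → select (i ≟ j) (g i)) ≡ g j
∑-select-≡ {suc n} g fzero    = trans (cong (g fzero +_) (sum-replicate-zero n)) (+-identityʳ _)
∑-select-≡ {suc n} g (fsuc j) = ∑-select-≡ (g ∘ fsuc) j

sum-map-tabulate : ∀ {n} {A : Set} (e : A → ℕ) (h : Fin n → A) → sum (map e (tabulate h)) ≡ ∑ (e ∘ h)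
sum-map-tabulate {zero}  e h = refl
sum-map-tabulate {suc n} e h = cong (e (h fzero) +_) (sum-map-tabulate e (h ∘ fsuc))

sum-filter-tabulate : ∀ {n} {A : Set} {P : Pred A 0ℓ} (P? : DecidablePred P)
                      (e : A → ℕ) (h : Fin n → A) →
                      sum (map e (filter P? (tabulate h))) ≡ ∑ (λ i → select (P? (h i)) (e (h i)))
sum-filter-tabulate {zero}  P? e h = refl
sum-filter-tabulate {suc n} P? e h with P? (h fzero)
... | yes _ = cong (e (h fzero) +_) (sum-filter-tabulate P? e (h ∘ fsuc))
... | no _  = sum-filter-tabulate P? e (h ∘ fsuc)

-- Maximal elements in a finite decidable partial order: above every element
-- satisfying a decidable property P lies a maximal element satisfying P.
-- Termination: the number of elements above x drops strictly when going up.
module Maximal {n} {_≼_ : Rel (Fin n) 0ℓ} (po : IsPartialOrder _≡_ _≼_)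
               (_≼?_ : Decidable _≼_) where
  open IsPartialOrder po using () renaming (refl to ≼-refl; trans to ≼-trans; antisym to ≼-antisym)

  IsMaximal : Pred (Fin n) 0ℓ → Fin n → Set
  IsMaximal P z = P z × (∀ w → P w → z ≼ w → w ≡ z)

  upCount : Fin n → ℕ
  upCount x = ∑ (λ w → select (x ≼? w) 1)

  upCount-< : ∀ {x y} → x ≼ y → x ≢ y → upCount y < upCount x
  upCount-< {x} {y} x≼y x≢y =
    ∑-mono-< (λ w → select-mono (y ≼? w) (x ≼? w) (≼-trans x≼y)) x
      (≤-trans (s≤s (≤-reflexive (select-no (y ≼? x) (λ y≼x → x≢y (≼-antisym x≼y y≼x)))))
               (≤-reflexive (sym (select-yes (x ≼? x) ≼-refl))))

  module _ {P : Pred (Fin n) 0ℓ} (P? : DecidablePred P) where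

    private
      climb : ∀ x → Acc _<_ (upCount x) → P x → Σ (Fin n) λ z → x ≼ z × IsMaximal P z
      climb x (acc rec) px with any? (λ w → P? w ×-dec (x ≼? w ×-dec ¬? (x ≟ w)))
      ... | yes (w , pw , x≼w , x≢w) =
        let z , w≼z , max-z = climb w (rec (upCount-< x≼w x≢w)) pw in z , ≼-trans x≼w w≼z , max-z
      ... | no nothing-above = x , ≼-refl , px , at-top
        where
        at-top : ∀ w → P w → x ≼ w → w ≡ x
        at-top w pw x≼w with x ≟ w
        ... | yes x≡w = sym x≡w
        ... | no x≢w  = ⊥-elim (nothing-above (w , pw , x≼w , x≢w))

    maximal-above : ∀ x → P x → Σ (Fin n) λ z → x ≼ z × IsMaximal P z
    maximal-above x = climb x (<-wellFounded (upCount x))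

module LatticeFacts (L : FinLattice) where
  open FinLattice L
  open LatticeNotions L
  open IsLattice isLattice using (isPartialOrder; supremum)
  open IsPartialOrder isPartialOrder public
    using () renaming (refl to ≤-reflL; trans to ≤-transL; antisym to ≤-antisymL)

  -- Decidability of the notions of Defs (all quantifiers range over Fin n).

  _<L?_ : Decidable _<L_
  x <L? y = ≤-dec x y ×-dec ¬? (x ≟ y)

  _≺?_ : Decidable _≺_
  x ≺? y = x <L? y ×-dec ¬? (any? λ z → x <L? z ×-dec z <L? y)

  IsMeetIrr? : ∀ x → Dec (IsMeetIrr x)
  IsMeetIrr? x = any? λ y → x ≺? y ×-dec all? λ z → x ≺? z →-dec z ≟ y

  InMminusMa? : ∀ a x → Dec (InMminusMa a x)
  InMminusMa? a x = IsMeetIrr? x ×-dec ¬? (≤-dec a x)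

  LabelSrc? : ∀ m x → Dec (LabelSrc m x)
  LabelSrc? m x = any? λ y → x ≺? y ×-dec (IsMeetIrr? m ×-dec ≤-dec x m)
                                     ×-dec ¬? (IsMeetIrr? m ×-dec ≤-dec y m)

  InU? : ∀ m a → Dec (InU m a)
  InU? m a = LabelSrc? m a ×-dec all? λ b → LabelSrc? m b →-dec (≤-dec b a →-dec b ≟ a)

  UIsBottomSingleton? : ∀ m → Dec (UIsBottomSingleton m)
  UIsBottomSingleton? m = all? λ a → (InU? m a →-dec IsBottom? a) ×-dec (IsBottom? a →-dec InU? m a)
    where
    IsBottom? : ∀ a → Dec (IsBottom a)
    IsBottom? a = all? (≤-dec a)

  -- If every element strictly above z lies above t', but z itself does not,
  -- then z ∨ t' is the unique upper cover of z: z is meet-irreducible.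
  meetIrr-below-join : ∀ {z t'} → ¬ (t' ≤L z) → (∀ w → z <L w → t' ≤L w) → IsMeetIrr z
  meetIrr-below-join {z} {t'} t'≰z above⇒t' = z ∨ t' , z≺j , unique
    where
    j = z ∨ t'
    z≤j : z ≤L j
    z≤j = proj₁ (supremum z t')
    t'≤j : t' ≤L j
    t'≤j = proj₁ (proj₂ (supremum z t'))
    j-least : ∀ w → z ≤L w → t' ≤L w → j ≤L w
    j-least = proj₂ (proj₂ (supremum z t'))
    z<j : z <L j
    z<j = z≤j , λ z≡j → t'≰z (subst (t' ≤L_) (sym z≡j) t'≤j)
    z≺j : z ≺ j
    z≺j = z<j , λ { (y , z<y , (y≤j , y≢j)) → y≢j (≤-antisymL y≤j (j-least y (proj₁ z<y) (above⇒t' y z<y))) }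
    unique : ∀ w → z ≺ w → w ≡ j
    unique w (z<w , nothing-between) with j ≟ w
    ... | yes j≡w = sym j≡w
    ... | no j≢w  = ⊥-elim (nothing-between (j , z<j , j-least w (proj₁ z<w) (above⇒t' w z<w) , j≢w))

  -- Every cover t ≺ t' is separated by a meet-irreducible x: t ≤ x, t' ≰ x.
  -- Take x maximal among the elements above t but not above t'.
  separating-meetIrr : ∀ {t t'} → t ≺ t' → Σ X λ x → IsMeetIrr x × t ≤L x × ¬ (t' ≤L x)
  separating-meetIrr {t} {t'} ((t≤t' , t≢t') , _)
    with Maximal.maximal-above isPartialOrder ≤-dec Separated? t (≤-reflL , t'≰t)
    where
    Separated? : ∀ w → Dec (t ≤L w × ¬ (t' ≤L w))
    Separated? w = ≤-dec t w ×-dec ¬? (≤-dec t' w)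
    t'≰t : ¬ (t' ≤L t)
    t'≰t t'≤t = t≢t' (≤-antisymL t≤t' t'≤t)
  ... | x , _ , (t≤x , t'≰x) , x-max = x , meetIrr-below-join t'≰x above⇒t' , t≤x , t'≰x
    where
    above⇒t' : ∀ w → x <L w → t' ≤L w
    above⇒t' w (x≤w , x≢w) with ≤-dec t' w
    ... | yes t'≤w = t'≤w
    ... | no t'≰w  = ⊥-elim (x≢w (sym (x-max w (≤-transL t≤x x≤w , t'≰w) x≤w)))

  labelSrc⇒aboveU : ∀ {m a} → LabelSrc m a → AboveU m a
  labelSrc⇒aboveU {m} {a} src =
    let z , z≤a , minimal = Maximal.maximal-above (Flip.isPartialOrder isPartialOrder) (flip ≤-dec) (LabelSrc? m) a src
    in z , minimal , z≤a

  labelSum : (X → ℕ) → X → ℕ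
  labelSum g c = ∑ λ x → select (InMminusMa? c x) (g x)

  labelSum-SumOver : ∀ g c → SumOver (InMminusMa c) g (labelSum g c)
  labelSum-SumOver g c =
      filter (InMminusMa? c) (allFin n)
    , filter⁺ (InMminusMa? c) (allFin⁺ n)
    , (λ x → proj₂ ∘ ∈-filter⁻ (InMminusMa? c) {xs = allFin n} , ∈-filter⁺ (InMminusMa? c) (∈-allFin x))
    , sum-filter-tabulate (InMminusMa? c) g id

  labelSum-mono : ∀ g {c d} → c ≤L d → labelSum g c ≤ labelSum g d
  labelSum-mono g c≤d = ∑-mono-≤ λ x →
    select-mono (InMminusMa? _ x) (InMminusMa? _ x) λ (mx , c≰x) → mx , c≰x ∘ ≤-transL c≤d

  labelSum-bottom : ∀ g {c} → IsBottom c → labelSum g c ≡ 0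
  labelSum-bottom g bottom = ∑-zero λ x → select-no (InMminusMa? _ x) λ (_ , c≰x) → c≰x (bottom x)

  labelSum-linear : ∀ g h D c → labelSum (λ x → g x + D * h x) c ≡ labelSum g c + D * labelSum h c
  labelSum-linear g h D c = begin
    ∑ (λ x → select (InMminusMa? c x) (g x + D * h x))
      ≡⟨ sum-cong-≗ (λ x → select-linear (InMminusMa? c x) (g x) D (h x)) ⟩
    ∑ (λ x → select (InMminusMa? c x) (g x) + D * select (InMminusMa? c x) (h x))
      ≡⟨ ∑-distrib-+ {n} _ _ ⟩
    labelSum g c + ∑ (λ x → D * select (InMminusMa? c x) (h x))
      ≡⟨ cong (labelSum g c +_) (sym (*-distribˡ-sum {n} D _)) ⟩
    labelSum g c + D * labelSum h c ∎
    where open ≡-Reasoning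

lookup-ext : ∀ {A : Set} {n} (a b : Vec A n) → (∀ i → lookup a i ≡ lookup b i) → a ≡ b
lookup-ext a b same = trans (sym (tabulate∘lookup a)) (trans (tabulate-cong same) (tabulate∘lookup b))

module Firing {k : ℕ} (E : Fin k → Fin k → ℕ) where
  open CFGNotions E

  Firable : Config → Fin k → Set
  Firable c u = outdeg u ≤ lookup c u

  StepBy : Fin k → Config → Config → Set
  StepBy u c d = ¬ IsSink u × Firable c u × d ≡ fire u c

  sent : Fin k → Fin k → ℕ
  sent u w = select (w ≟ u) (outdeg u)

  sentBy : Fin k → Fin k → ℕ
  sentBy v u = sent u v

  -- The entries of a fired configuration (Defs writes the correction term
  -- with ⌊_⌋, which agrees with select).
  lookup-fire : ∀ c u w → lookup (fire u c) w ≡ (lookup c w + E u w) ∸ sent u w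
  lookup-fire c u w = trans (lookup∘tabulate _ w)
    (cong (λ b → (lookup c w + E u w) ∸ (if b then outdeg u else 0)) (isYes≗does (w ≟ u)))

  fire-balance : ∀ c u w → Firable c u → lookup (fire u c) w + sent u w ≡ lookup c w + E u w
  fire-balance c u w u-firable rewrite lookup-fire c u w with w ≟ u
  ... | yes refl = m∸n+n≡m (≤-trans u-firable (m≤m+n _ _))
  ... | no _     = +-identityʳ _

  fire-self : ∀ c u → Firable c u → lookup (fire u c) u + outdeg u ≡ lookup c u + E u u
  fire-self c u u-firable =
    trans (cong (lookup (fire u c) u +_) (sym (select-yes (u ≟ u) refl))) (fire-balance c u u u-firable)

  fire-other : ∀ c u w → w ≢ u → lookup (fire u c) w ≡ lookup c w + E u w
  fire-other c u w w≢u rewrite lookup-fire c u w with w ≟ u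
  ... | yes w≡u = ⊥-elim (w≢u w≡u)
  ... | no _    = refl

  firable-other : ∀ c u v → Firable c v → v ≢ u → Firable (fire u c) v
  firable-other c u v v-firable v≢u =
    ≤-trans v-firable (≤-trans (m≤m+n _ _) (≤-reflexive (sym (fire-other c u v v≢u))))

  loops<outdeg : ∀ u → ¬ IsSink u → E u u < outdeg u
  loops<outdeg u non-sink with E u u <? outdeg u
  ... | yes loops<out = loops<out
  ... | no loops≮out = ⊥-elim (non-sink sink)
    where
    outdeg≡∑ : outdeg u ≡ ∑ (E u)
    outdeg≡∑ = sum-map-tabulate (E u) id
    sink : IsSink u
    sink w w≢u = n≤0⇒n≡0 (+-cancelʳ-≤ (E u u) (E u w) 0
      (≤-trans (∑-two-terms (E u) w≢u) (≤-trans (≤-reflexive (sym outdeg≡∑)) (≮⇒≥ loops≮out))))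

  fire-decreases : ∀ c u → ¬ IsSink u → Firable c u → lookup (fire u c) u < lookup c u
  fire-decreases c u non-sink u-firable = +-cancelʳ-< (outdeg u) _ _ (begin-strict
    lookup (fire u c) u + outdeg u ≡⟨ fire-self c u u-firable ⟩
    lookup c u + E u u             <⟨ +-monoʳ-< (lookup c u) (loops<outdeg u non-sink) ⟩
    lookup c u + outdeg u          ∎)
    where open ≤-Reasoning

  fire-injective : ∀ c u v → ¬ IsSink u → Firable c u → fire u c ≡ fire v c → u ≡ v
  fire-injective c u v non-sink u-firable same with u ≟ v
  ... | yes u≡v = u≡v
  ... | no u≢v  = ⊥-elim (<⇒≱ (fire-decreases c u non-sink u-firable) (begin
    lookup c u               ≤⟨ m≤m+n _ _ ⟩
    lookup c u + E v u       ≡⟨ sym (fire-other c v u u≢v) ⟩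
    lookup (fire v c) u      ≡⟨ cong (λ d → lookup d u) (sym same) ⟩
    lookup (fire u c) u      ∎))
    where open ≤-Reasoning

  fire-twice : ∀ c u v → Firable c u → Firable (fire u c) v → ∀ w →
               lookup (fire v (fire u c)) w + (sent u w + sent v w) ≡ lookup c w + (E u w + E v w)
  fire-twice c u v u-firable v-firable w = begin
    lookup (fire v d) w + (sent u w + sent v w) ≡⟨ x∙yz≈xz∙y (lookup (fire v d) w) (sent u w) (sent v w) ⟩
    lookup (fire v d) w + sent v w + sent u w   ≡⟨ cong (_+ sent u w) (fire-balance d v w v-firable) ⟩
    lookup d w + E v w + sent u w               ≡⟨ xy∙z≈xz∙y (lookup d w) (E v w) (sent u w) ⟩
    lookup d w + sent u w + E v w               ≡⟨ cong (_+ E v w) (fire-balance c u w u-firable) ⟩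
    lookup c w + E u w + E v w                  ≡⟨ +-assoc (lookup c w) (E u w) (E v w) ⟩
    lookup c w + (E u w + E v w)                ∎
    where
    open ≡-Reasoning
    d = fire u c

  fire-commute : ∀ c u v → Firable c u → Firable c v → u ≢ v → fire v (fire u c) ≡ fire u (fire v c)
  fire-commute c u v u-firable v-firable u≢v = lookup-ext _ _ λ w →
    +-cancelʳ-≡ (sent u w + sent v w) _ _ (begin
      lookup (fire v (fire u c)) w + (sent u w + sent v w)
        ≡⟨ fire-twice c u v u-firable (firable-other c u v v-firable (u≢v ∘ sym)) w ⟩
      lookup c w + (E u w + E v w)
        ≡⟨ cong (lookup c w +_) (+-comm (E u w) (E v w)) ⟩
      lookup c w + (E v w + E u w)
        ≡⟨ sym (fire-twice c v u v-firable (firable-other c v u u-firable u≢v) w) ⟩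
      lookup (fire u (fire v c)) w + (sent v w + sent u w)
        ≡⟨ cong (lookup (fire u (fire v c)) w +_) (+-comm (sent v w) (sent u w)) ⟩
      lookup (fire u (fire v c)) w + (sent u w + sent v w) ∎)
    where open ≡-Reasoning

-- In the application d is the outdegree of a vertex v, o its initial chips,
-- K the chips v has sent when reaching m, and i, a the chips received and
-- held by v at some element; the hypothesis a + K ≡ o + i is chip conservation.

-- At an element that can fire v after sending K chips, the sum reaches w.
bound-fires : ∀ D K d o {a i} → d ≤ a → a + K ≡ o + i → (D * K + K + d) ∸ o ≤ i + D * K
bound-fires D K d o {a} {i} d≤a balanced = m≤n+o⇒m∸n≤o (D * K + K + d) o (begin
  D * K + K + d   ≤⟨ +-monoʳ-≤ (D * K + K) d≤a ⟩
  D * K + K + a   ≡⟨ xy∙z≈x∙zy (D * K) K a ⟩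
  D * K + (a + K) ≡⟨ cong (D * K +_) balanced ⟩
  D * K + (o + i) ≡⟨ x∙yz≈y∙zx (D * K) o i ⟩
  o + (i + D * K) ∎)
  where open ≤-Reasoning

-- At an element that cannot fire v after sending K chips, the sum stays below w.
bound-stuck : ∀ D K d o {a i} → a < d → a + K ≡ o + i → i + D * K < (D * K + K + d) ∸ o
bound-stuck D K d o {a} {i} a<d balanced = m+n≤o⇒m≤o∸n (suc (i + D * K)) (begin
  suc (i + D * K) + o   ≡⟨ rearrange i (D * K) o ⟩
  suc (o + i) + D * K   ≡⟨ cong (λ x → suc x + D * K) (sym balanced) ⟩
  suc (a + K) + D * K   ≤⟨ +-monoˡ-≤ (D * K) (+-monoˡ-≤ K a<d) ⟩
  d + K + D * K         ≡⟨ reverse d K (D * K) ⟩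
  D * K + K + d         ∎)
  where
  open ≤-Reasoning
  rearrange : ∀ i P o → suc (i + P) + o ≡ suc (o + i) + P
  rearrange = solve-∀
  reverse : ∀ d K P → d + K + P ≡ P + K + d
  reverse = solve-∀

-- At an element that has sent fewer than K chips, and received at most I,
-- the sum stays below w as soon as D > I + o.
bound-behind : ∀ K d o {i I j} → j < K → i ≤ I →
               i + suc (I + o) * j < (suc (I + o) * K + K + d) ∸ o
bound-behind K d o {i} {I} {j} j<K i≤I = m+n≤o⇒m≤o∸n (suc (i + D * j)) (begin
  suc (i + D * j) + o   ≤⟨ +-monoˡ-≤ o (s≤s (+-monoˡ-≤ (D * j) i≤I)) ⟩
  suc (I + D * j) + o   ≡⟨ rearrange I (D * j) o ⟩
  D + D * j             ≡⟨ sym (*-suc D j) ⟩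
  D * suc j             ≤⟨ *-monoʳ-≤ D j<K ⟩
  D * K                 ≤⟨ m≤m+n (D * K) K ⟩
  D * K + K             ≤⟨ m≤m+n (D * K + K) d ⟩
  D * K + K + d         ∎)
  where
  open ≤-Reasoning
  D = suc (I + o)
  rearrange : ∀ I x o → suc (I + x) + o ≡ suc (I + o) + x
  rearrange = solve-∀

module Generated (L : FinLattice) {k : ℕ} (E : Fin k → Fin k → ℕ) (O : Vec ℕ k)
                 (gen : GeneratedBy L E O) where
  open FinLattice L
  open LatticeNotions L
  open LatticeFacts L
  open CFGNotions E
  open Firing E

  f : X → Config
  f = proj₁ gen

  reachable : ∀ x → Reach O (f x)
  reachable = proj₁ (proj₂ gen)

  element : ∀ {c} → Reach O c → Σ X λ x → f x ≡ c
  element = proj₁ (proj₂ (proj₂ gen)) _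

  reach⇒≤ : ∀ {x y} → Reach (f x) (f y) → x ≤L y
  reach⇒≤ {x} {y} = proj₂ (proj₂ (proj₂ (proj₂ gen)) x y)

  f-injective : ∀ {x y} → f x ≡ f y → x ≡ y
  f-injective {x} fx≡fy = ≤-antisymL (reach⇒≤ (subst (Reach (f x)) fx≡fy ε))
                                     (reach⇒≤ (subst (λ c → Reach c (f x)) fx≡fy ε))

  -- Steps between lattice elements: x ⟶[ u ] y when firing u turns f x
  -- into f y.  (x ⟶ y is then literally Step (f x) (f y).)
  _⟶[_]_ : X → Fin k → X → Set
  x ⟶[ u ] y = StepBy u (f x) (f y)

  _⟶_ : Rel X 0ℓ
  x ⟶ y = Σ (Fin k) λ u → x ⟶[ u ] y

  Avoiding : Fin k → Rel X 0ℓ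
  Avoiding u x y = Σ (Fin k) λ u' → u' ≢ u × x ⟶[ u' ] y

  path⇒≤ : ∀ {x y} → Star _⟶_ x y → x ≤L y
  path⇒≤ π = reach⇒≤ (gmap f id π)

  ⟶⇒≤ : ∀ {x y} → x ⟶ y → x ≤L y
  ⟶⇒≤ st = path⇒≤ (st ◅ ε)

  -- Reachability between elements is a path of lattice steps, since every
  -- configuration on the way is reachable from O.
  ≤⇒path : ∀ {x y} → x ≤L y → Star _⟶_ x y
  ≤⇒path {x} {y} x≤y = lift-path (proj₁ (proj₂ (proj₂ (proj₂ gen)) x y) x≤y) x refl
    where
    lift-path : ∀ {c} → Star Step c (f y) → ∀ x → f x ≡ c → Star _⟶_ x y
    lift-path ε x fx≡fy = subst (Star _⟶_ x) (f-injective fx≡fy) ε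
    lift-path (s ◅ π) x refl with element (reachable x ◅◅ (s ◅ ε))
    ... | x₁ , refl = s ◅ lift-path π x₁ refl

  step-exists : ∀ {x u} → ¬ IsSink u → Firable (f x) u → Σ X λ y → x ⟶[ u ] y
  step-exists {x} {u} non-sink firable with element (reachable x ◅◅ ((u , non-sink , firable , refl) ◅ ε))
  ... | y , fy = y , non-sink , firable , fy

  ⟶-deterministic : ∀ {x y y' u} → x ⟶[ u ] y → x ⟶[ u ] y' → y ≡ y'
  ⟶-deterministic (_ , _ , fy) (_ , _ , fy') = f-injective (trans fy (sym fy'))

  ⟶-vertex-unique : ∀ {x y u u'} → x ⟶[ u ] y → x ⟶[ u' ] y → u ≡ u'
  ⟶-vertex-unique {x} {u = u} {u'} (non-sink , firable , fy) (_ , _ , fy') =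
    fire-injective (f x) u u' non-sink firable (trans (sym fy) fy')

  ⟶-irreflexive : ∀ {x y} → x ⟶ y → x ≢ y
  ⟶-irreflexive {x} (u , non-sink , firable , fx) refl =
    <-irrefl (cong (λ c → lookup c u) (sym fx)) (fire-decreases (f x) u non-sink firable)

  ⟶⇒< : ∀ {x y} → x ⟶ y → x <L y
  ⟶⇒< st = ⟶⇒≤ st , ⟶-irreflexive st

  ⟶-not-back : ∀ {x y} → x ⟶ y → ¬ (y ≤L x)
  ⟶-not-back st y≤x = ⟶-irreflexive st (≤-antisymL (⟶⇒≤ st) y≤x)

  first-step : ∀ {x y} → x ≤L y → x ≢ y → Σ X λ x₁ → x ⟶ x₁ × x₁ ≤L y
  first-step x≤y x≢y with ≤⇒path x≤y
  ... | ε       = ⊥-elim (x≢y refl)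
  ... | st ◅ π  = _ , st , path⇒≤ π

  diamond : ∀ {x y x' u u'} → x ⟶[ u ] y → x ⟶[ u' ] x' → u ≢ u' →
            Σ X λ y' → x' ⟶[ u ] y' × y ⟶[ u' ] y'
  diamond {x} {y} {x'} {u} {u'} (u-non-sink , u-firable , fy) (u'-non-sink , u'-firable , fx') u≢u'
    with step-exists {x'} u-non-sink u-firable-at-x'
    where
    u-firable-at-x' : Firable (f x') u
    u-firable-at-x' = subst (λ c → Firable c u) (sym fx') (firable-other (f x) u' u u-firable u≢u')
  ... | y' , x'⟶y'@(_ , _ , fy') = y' , x'⟶y' , u'-non-sink , u'-firable-at-y , (begin
    f y'                   ≡⟨ fy' ⟩
    fire u (f x')          ≡⟨ cong (fire u) fx' ⟩
    fire u (fire u' (f x)) ≡⟨ fire-commute (f x) u' u u'-firable u-firable (u≢u' ∘ sym) ⟩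
    fire u' (fire u (f x)) ≡⟨ cong (fire u') (sym fy) ⟩
    fire u' (f y)          ∎)
    where
    open ≡-Reasoning
    u'-firable-at-y : Firable (f y) u'
    u'-firable-at-y = subst (λ c → Firable c u') (sym fy) (firable-other (f x) u u' u'-firable (u≢u' ∘ sym))

  outside-up : ∀ {a b x} → a ≤L b → ¬ (a ≤L x) → ¬ (b ≤L x)
  outside-up a≤b a≰x b≤x = a≰x (≤-transL a≤b b≤x)

  push-step : ∀ {s s' s₁ x u u₁} → s ⟶[ u ] s' → ¬ (s' ≤L x) → s ⟶[ u₁ ] s₁ → s₁ ≤L x →
              u₁ ≢ u × Σ X λ s₁' → s₁ ⟶[ u ] s₁' × s' ≤L s₁'
  push-step {u = u} {u₁} exit s'≰x st s₁≤x with u₁ ≟ u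
  ... | yes refl = ⊥-elim (s'≰x (subst (_≤L _) (⟶-deterministic st exit) s₁≤x))
  ... | no u₁≢u with diamond exit st (u₁≢u ∘ sym)
  ...   | s₁' , exit₁ , s'⟶s₁' = u₁≢u , s₁' , exit₁ , ⟶⇒≤ (_ , s'⟶s₁')

  push-exit : ∀ {s s' x u} → s ⟶[ u ] s' → ¬ (s' ≤L x) → Star _⟶_ s x →
              Star (Avoiding u) s x × Σ X λ x' → x ⟶[ u ] x'
  push-exit exit s'≰x ε = ε , _ , exit
  push-exit exit s'≰x ((u₁ , st) ◅ π) with push-step exit s'≰x st (path⇒≤ π)
  ... | u₁≢u , _ , exit₁ , s'≤s₁' with push-exit exit₁ (outside-up s'≤s₁' s'≰x) π
  ...   | avoiding , at-end = (u₁ , u₁≢u , st) ◅ avoiding , at-end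

  chips-mono : ∀ {u x y} → Star (Avoiding u) x y → lookup (f x) u ≤ lookup (f y) u
  chips-mono ε = ≤-refl
  chips-mono {u} {x} ((u₁ , u₁≢u , _ , _ , fy) ◅ π) = ≤-trans (begin
    lookup (f x) u           ≤⟨ m≤m+n _ _ ⟩
    lookup (f x) u + E u₁ u  ≡⟨ sym (fire-other (f x) u₁ u (u₁≢u ∘ sym)) ⟩
    lookup (fire u₁ (f x)) u ≡⟨ cong (λ c → lookup c u) (sym fy) ⟩
    lookup (f _) u           ∎) (chips-mono π)
    where open ≤-Reasoning

  -- If x ⟶[ u ] y, then y cannot be reached from x by first firing another
  -- vertex u': pushing the u-firing along shows the detour never fires u,
  -- so it cannot lose the chips that firing u loses.
  no-detour : ∀ {x y x₁ u u'} → x ⟶[ u ] y → x ⟶[ u' ] x₁ → u' ≢ u → Star _⟶_ x₁ y → ⊥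
  no-detour {x} {y} {u = u} x⟶y@(non-sink , firable , fy) x⟶x₁ u'≢u π
    with diamond x⟶y x⟶x₁ (u'≢u ∘ sym)
  ... | _ , x₁⟶y₁ , y⟶y₁ with push-exit x₁⟶y₁ (⟶-not-back (_ , y⟶y₁)) π
  ...   | avoiding , _ = <⇒≱ u-loses (chips-mono ((_ , u'≢u , x⟶x₁) ◅ avoiding))
    where
    u-loses : lookup (f y) u < lookup (f x) u
    u-loses = subst (λ c → lookup c u < lookup (f x) u) (sym fy) (fire-decreases (f x) u non-sink firable)

  step⇒cover : ∀ {x y} → x ⟶ y → x ≺ y
  step⇒cover {x} {y} (u , x⟶y) = ⟶⇒< (u , x⟶y) , nothing-between
    where
    nothing-between : ¬ Σ X λ z → x <L z × z <L y
    nothing-between (z , (x≤z , x≢z) , (z≤y , z≢y)) with first-step x≤z x≢z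
    ... | x₁ , (u' , x⟶x₁) , x₁≤z with u' ≟ u
    ...   | yes refl = z≢y (≤-antisymL z≤y (subst (_≤L z) (⟶-deterministic x⟶x₁ x⟶y) x₁≤z))
    ...   | no u'≢u  = no-detour x⟶y x⟶x₁ u'≢u (≤⇒path (≤-transL x₁≤z z≤y))

  cover⇒step : ∀ {x y} → x ≺ y → x ⟶ y
  cover⇒step {y = y} ((x≤y , x≢y) , nothing-between) with first-step x≤y x≢y
  ... | x₁ , x⟶x₁ , x₁≤y with x₁ ≟ y
  ...   | yes refl = x⟶x₁
  ...   | no x₁≢y  = ⊥-elim (nothing-between (x₁ , ⟶⇒< x⟶x₁ , x₁≤y , x₁≢y))

  vertexOf : ∀ {x} → IsMeetIrr x → Fin k
  vertexOf (_ , x≺x* , _) = proj₁ (cover⇒step x≺x*)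

  vertexOf-step : ∀ {x y u} (p : IsMeetIrr x) → x ⟶[ u ] y → vertexOf p ≡ u
  vertexOf-step (_ , x≺x* , unique) x⟶y with unique _ (step⇒cover (_ , x⟶y))
  ... | refl = ⟶-vertex-unique (proj₂ (cover⇒step x≺x*)) x⟶y

  exit-vertex : ∀ {x t t' u} (p : IsMeetIrr x) → t ≤L x → ¬ (t' ≤L x) → t ⟶[ u ] t' → vertexOf p ≡ u
  exit-vertex p t≤x t'≰x exit with push-exit exit t'≰x (≤⇒path t≤x)
  ... | _ , _ , x⟶x' = vertexOf-step p x⟶x'

  meetIrr-exit : ∀ {x y z} → IsMeetIrr x → x ≤L z → x ⟶ y → ¬ (y ≤L z) → x ≡ z
  meetIrr-exit {x} {y} {z} (_ , _ , unique) x≤z x⟶y y≰z with x ≟ z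
  ... | yes x≡z = x≡z
  ... | no x≢z with first-step x≤z x≢z
  ...   | x₁ , x⟶x₁ , x₁≤z =
    ⊥-elim (y≰z (subst (_≤L z) (trans (unique x₁ (step⇒cover x⟶x₁)) (sym (unique y (step⇒cover x⟶y))))
                       x₁≤z))

  -- Walk from t up to x₁, pushing the exit step along,
  -- while staying below x₂; leaving ↓x₂ would fire the vertex of x₂ twice.
  label-unique : ∀ {t t' x₁ x₂ u} → t ⟶[ u ] t' → IsMeetIrr x₁ → IsMeetIrr x₂ →
                 t ≤L x₁ → ¬ (t' ≤L x₁) → t ≤L x₂ → ¬ (t' ≤L x₂) → x₁ ≡ x₂
  label-unique {x₁ = x₁} {x₂} exit p₁ p₂ t≤x₁ t'≰x₁ t≤x₂ t'≰x₂ =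
    walk (≤⇒path t≤x₁) exit t≤x₂ t'≰x₁ t'≰x₂
    where
    walk : ∀ {s s' u} → Star _⟶_ s x₁ → s ⟶[ u ] s' → s ≤L x₂ →
           ¬ (s' ≤L x₁) → ¬ (s' ≤L x₂) → x₁ ≡ x₂
    walk ε exit s≤x₂ _ s'≰x₂ = meetIrr-exit p₁ s≤x₂ (_ , exit) s'≰x₂
    walk ((u₁ , st) ◅ π) exit s≤x₂ s'≰x₁ s'≰x₂ with push-step exit s'≰x₁ st (path⇒≤ π)
    ... | u₁≢u , s₁' , exit₁ , s'≤s₁' with ≤-dec _ x₂
    ...   | yes s₁≤x₂ = walk π exit₁ s₁≤x₂ (outside-up s'≤s₁' s'≰x₁) (outside-up s'≤s₁' s'≰x₂)
    ...   | no s₁≰x₂  =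
      ⊥-elim (u₁≢u (trans (sym (exit-vertex p₂ s≤x₂ s₁≰x₂ st)) (exit-vertex p₂ s≤x₂ s'≰x₂ exit)))

  labelSum-step : ∀ g {t t' u} → t ⟶[ u ] t' →
                  Σ X λ ℓ → IsMeetIrr ℓ × t ≤L ℓ × ¬ (t' ≤L ℓ) × labelSum g t' ≡ labelSum g t + g ℓ
  labelSum-step g {t} {t'} {u} exit with separating-meetIrr (step⇒cover (u , exit))
  ... | ℓ , ℓ-irr , t≤ℓ , t'≰ℓ = ℓ , ℓ-irr , t≤ℓ , t'≰ℓ , (begin
    labelSum g t'
      ≡⟨ sum-cong-≗ split ⟩
    ∑ (λ x → select (InMminusMa? t x) (g x) + select (x ≟ ℓ) (g x))
      ≡⟨ ∑-distrib-+ {n} _ _ ⟩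
    labelSum g t + ∑ (λ x → select (x ≟ ℓ) (g x))
      ≡⟨ cong (labelSum g t +_) (∑-select-≡ g ℓ) ⟩
    labelSum g t + g ℓ ∎)
    where
    open ≡-Reasoning
    split : ∀ x → select (InMminusMa? t' x) (g x) ≡ select (InMminusMa? t x) (g x) + select (x ≟ ℓ) (g x)
    split x = select-⊎ (InMminusMa? t' x) (InMminusMa? t x) (x ≟ ℓ) to from disjoint
      where
      to : InMminusMa t' x → InMminusMa t x ⊎ x ≡ ℓ
      to (x-irr , t'≰x) with ≤-dec t x
      ... | yes t≤x = inj₂ (label-unique exit x-irr ℓ-irr t≤x t'≰x t≤ℓ t'≰ℓ)
      ... | no t≰x  = inj₁ (x-irr , t≰x)
      from : InMminusMa t x ⊎ x ≡ ℓ → InMminusMa t' x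
      from (inj₁ (x-irr , t≰x)) = x-irr , λ t'≤x → t≰x (≤-transL (⟶⇒≤ (u , exit)) t'≤x)
      from (inj₂ refl)          = ℓ-irr , t'≰ℓ
      disjoint : InMminusMa t x → x ≢ ℓ
      disjoint (_ , t≰x) refl = t≰x t≤ℓ

  weight : (Fin k → ℕ) → X → ℕ
  weight φ x with IsMeetIrr? x
  ... | yes x-irr = φ (vertexOf x-irr)
  ... | no _      = 0

  weight-exit : ∀ φ {x t t' u} → IsMeetIrr x → t ≤L x → ¬ (t' ≤L x) → t ⟶[ u ] t' → weight φ x ≡ φ u
  weight-exit φ {x} x-irr t≤x t'≰x exit with IsMeetIrr? x
  ... | yes x-irr' = cong φ (exit-vertex x-irr' t≤x t'≰x exit)
  ... | no ¬irr    = ⊥-elim (¬irr x-irr)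

  -- W φ c = ∑_{x ∈ M ∖ M_c} φ(vertex of x): the total φ-weight of the
  -- firings leading from 𝟎 to c (one firing per label, see W-step).
  W : (Fin k → ℕ) → X → ℕ
  W φ = labelSum (weight φ)

  W-step : ∀ φ {t t' u} → t ⟶[ u ] t' → W φ t' ≡ W φ t + φ u
  W-step φ exit with labelSum-step (weight φ) exit
  ... | ℓ , ℓ-irr , t≤ℓ , t'≰ℓ , W-grows =
    trans W-grows (cong (W φ _ +_) (weight-exit φ ℓ-irr t≤ℓ t'≰ℓ exit))

  W-avoiding : ∀ φ {u x y} → (∀ u' → u' ≢ u → φ u' ≡ 0) → Star (Avoiding u) x y → W φ y ≡ W φ x
  W-avoiding φ vanishes ε = refl
  W-avoiding φ vanishes ((u' , u'≢u , st) ◅ π) =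
    trans (W-avoiding φ vanishes π) (trans (W-step φ st) (trans (cong (W φ _ +_) (vanishes u' u'≢u)) (+-identityʳ _)))

  𝟎 : X
  𝟎 = proj₁ (element ε)

  f𝟎 : f 𝟎 ≡ O
  f𝟎 = proj₂ (element ε)

  𝟎-least : IsBottom 𝟎
  𝟎-least y = reach⇒≤ (subst (λ c → Reach c (f y)) (sym f𝟎) (reachable y))

  balance : ∀ v c → lookup (f c) v + W (sentBy v) c ≡ lookup O v + W (λ u → E u v) c
  balance v c = along (≤⇒path (𝟎-least c)) at-𝟎
    where
    Out In : X → ℕ
    Out = W (sentBy v)
    In  = W (λ u → E u v)

    Balanced : X → Set
    Balanced c = lookup (f c) v + Out c ≡ lookup O v + In c

    at-𝟎 : Balanced 𝟎
    at-𝟎 = begin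
      lookup (f 𝟎) v + Out 𝟎 ≡⟨ cong₂ (λ c s → lookup c v + s) f𝟎 (labelSum-bottom _ 𝟎-least) ⟩
      lookup O v + 0         ≡⟨ cong (lookup O v +_) (sym (labelSum-bottom _ 𝟎-least)) ⟩
      lookup O v + In 𝟎      ∎
      where open ≡-Reasoning

    step : ∀ {x y u} → x ⟶[ u ] y → Balanced x → Balanced y
    step {x} {y} {u} st@(_ , firable , fy) balanced-x = begin
      lookup (f y) v + Out y                     ≡⟨ cong (lookup (f y) v +_) (W-step (sentBy v) st) ⟩
      lookup (f y) v + (Out x + sent u v)        ≡⟨ x∙yz≈xz∙y (lookup (f y) v) (Out x) (sent u v) ⟩
      lookup (f y) v + sent u v + Out x          ≡⟨ cong (λ c → lookup c v + sent u v + Out x) fy ⟩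
      lookup (fire u (f x)) v + sent u v + Out x ≡⟨ cong (_+ Out x) (fire-balance (f x) u v firable) ⟩
      lookup (f x) v + E u v + Out x             ≡⟨ xy∙z≈xz∙y (lookup (f x) v) (E u v) (Out x) ⟩
      lookup (f x) v + Out x + E u v             ≡⟨ cong (_+ E u v) balanced-x ⟩
      lookup O v + In x + E u v                  ≡⟨ +-assoc (lookup O v) (In x) (E u v) ⟩
      lookup O v + (In x + E u v)                ≡⟨ cong (lookup O v +_) (sym (W-step (λ u → E u v) st)) ⟩
      lookup O v + In y                          ∎
      where open ≡-Reasoning

    along : ∀ {x y} → Star _⟶_ x y → Balanced x → Balanced y
    along ε                balanced = balanced
    along ((_ , st) ◅ π)   balanced = along π (step st balanced)

  -- Let v be the vertex fired
  -- along the upper cover of m, K the chips v has sent out when reaching m,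
  -- and give x ∈ M the weight e x = (chips v receives by firing x's vertex)
  -- + D·(chips v sends by it), for D large.
  module SystemFor (m : X) (m-irr : IsMeetIrr m) where

    v : Fin k
    v = vertexOf m-irr

    v-non-sink : ¬ IsSink v
    v-non-sink = proj₁ (proj₂ (cover⇒step (proj₁ (proj₂ m-irr))))

    Out In : X → ℕ
    Out = W (sentBy v)
    In  = W (λ u → E u v)

    K D w : ℕ
    K = Out m
    D = suc (In m + lookup O v)
    w = (D * K + K + outdeg v) ∸ lookup O v

    e : X → ℕ
    e x = weight (λ u → E u v) x + D * weight (sentBy v) x

    e-sum : ∀ c → labelSum e c ≡ In c + D * Out c
    e-sum = labelSum-linear _ _ D

    sentBy-other : ∀ u → u ≢ v → sentBy v u ≡ 0
    sentBy-other u u≢v = select-no (v ≟ u) (u≢v ∘ sym)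

    sentBy-self : sentBy v v ≡ outdeg v
    sentBy-self = select-yes (v ≟ v) refl

    outside-m : ∀ {y} → ¬ InMx y m → ¬ (y ≤L m)
    outside-m y∉Mm y≤m = y∉Mm (m-irr , y≤m)

    balance-at : ∀ {c} → Out c ≡ K → lookup (f c) v + K ≡ lookup O v + In c
    balance-at {c} Out≡K = subst (λ s → lookup (f c) v + s ≡ lookup O v + In c) Out≡K (balance v c)

    -- An m-labelled cover a ≺ y fires v, and no firing of v happens between
    -- a and m: so v can fire at a, which has already sent K chips.
    source-facts : ∀ {a} → LabelSrc m a → Out a ≡ K × Firable (f a) v
    source-facts (y , a≺y , (_ , a≤m) , y∉Mm) with cover⇒step a≺y
    ... | u , exit with exit-vertex m-irr a≤m (outside-m y∉Mm) exit
    ...   | refl with push-exit exit (outside-m y∉Mm) (≤⇒path a≤m)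
    ...     | avoiding , _ = sym (W-avoiding (sentBy v) sentBy-other avoiding) , proj₁ (proj₂ exit)

    leave-down-m : ∀ {s b} → Star _⟶_ s b → s ≤L m → ¬ (b ≤L m) → Σ X λ a → LabelSrc m a × a ≤L b
    leave-down-m ε s≤m b≰m = ⊥-elim (b≰m s≤m)
    leave-down-m {s} (st ◅ π) s≤m b≰m with ≤-dec _ m
    ... | yes s₁≤m = leave-down-m π s₁≤m b≰m
    ... | no s₁≰m  = s , (_ , step⇒cover st , (m-irr , s≤m) , s₁≰m ∘ proj₂) , path⇒≤ (st ◅ π)

    below-m : ∀ {b} → ¬ AboveU m b → b ≤L m
    below-m {b} b∉↑U with ≤-dec b m
    ... | yes b≤m = b≤m
    ... | no b≰m with leave-down-m (≤⇒path (𝟎-least b)) (𝟎-least m) b≰m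
    ...   | a , src , a≤b with labelSrc⇒aboveU src
    ...     | z , z∈U , z≤a = ⊥-elim (b∉↑U (z , z∈U , ≤-transL z≤a a≤b))

    -- ... and if they have sent K chips, v cannot fire there: firing v would
    -- either exceed K chips sent below m, or cross an m-labelled cover.
    stuck : ∀ {b} → ¬ AboveU m b → Out b ≡ K → ¬ Firable (f b) v
    stuck {b} b∉↑U Out≡K firable with step-exists v-non-sink firable
    ... | b' , exit with ≤-dec b' m
    ...   | no b'≰m  =
      b∉↑U (labelSrc⇒aboveU (b' , step⇒cover (v , exit) , (m-irr , below-m b∉↑U) , b'≰m ∘ proj₂))
    ...   | yes b'≤m = <⇒≱ K<Out-b' (labelSum-mono _ b'≤m)
      where
      K<Out-b' : K < Out b'
      K<Out-b' = begin-strict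
        K                  ≡⟨ sym Out≡K ⟩
        Out b              <⟨ m<m+n (Out b) (≤-<-trans z≤n (loops<outdeg v v-non-sink)) ⟩
        Out b + outdeg v   ≡⟨ cong (Out b +_) (sym sentBy-self) ⟩
        Out b + sentBy v v ≡⟨ sym (W-step (sentBy v) exit) ⟩
        Out b'             ∎
        where open ≤-Reasoning

    at-U : ∀ a → InU m a → Σ ℕ λ s → SumOver (InMminusMa a) e s × w ≤ s
    at-U a (src , _) with source-facts src
    ... | Out≡K , firable = labelSum e a , labelSum-SumOver e a ,
      subst (w ≤_) (sym (trans (e-sum a) (cong (λ s → In a + D * s) Out≡K)))
            (bound-fires D K (outdeg v) (lookup O v) firable (balance-at Out≡K))

    at-L : ∀ b → InLm m b → Σ ℕ λ s → SumOver (InMminusMa b) e s × s < w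
    at-L b (b∉↑U , _) = labelSum e b , labelSum-SumOver e b , subst (_< w) (sym (e-sum b)) below-w
      where
      b≤m = below-m b∉↑U
      below-w : In b + D * Out b < w
      below-w with m≤n⇒m<n∨m≡n (labelSum-mono (weight (sentBy v)) b≤m)
      ... | inj₁ Out<K = bound-behind K (outdeg v) (lookup O v) Out<K (labelSum-mono _ b≤m)
      ... | inj₂ Out≡K = subst (λ s → In b + D * s < w) (sym Out≡K)
                               (bound-stuck D K (outdeg v) (lookup O v) (≰⇒> (stuck b∉↑U Out≡K)) (balance-at Out≡K))

    solution : HasNatSolution m
    solution with UIsBottomSingleton? m
    ... | yes only-𝟎 = 1 , (λ _ → 0) , (λ _ → s≤s z≤n) , λ not-only-𝟎 → ⊥-elim (not-only-𝟎 only-𝟎)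
    ... | no not-only-𝟎 = w , e , (λ only-𝟎 → ⊥-elim (not-only-𝟎 only-𝟎)) , λ _ → at-L , at-U

open LatticeNotions

mainTheorem10 : (L : FinLattice) → UpperLocallyDistributive L → InLCFG L →
    ∀ m → IsMeetIrr L m → HasNatSolution L m
mainTheorem10 L _ (k , E , O , _ , generated) m m-irr =
  Generated.SystemFor.solution L E O generated m m-irr
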